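{- Let $((A_\xi)_{\xi\in I},\mathcal{F})$ be an algebra. Suppose $\vec e\in\Omega$, $\vec e\,'$ is any sort with $\vec e\,'(0)=\vec e(0)$, $\vec a$ is $\vec e$-sorted, $\vec a\,'$ is $\vec e\,'$-sorted, and $\vec a\,'\le_\mathcal{F}\vec a$. Then $\mathrm{FR}^{\vec e\,'}_\mathcal{F}(\vec a\,')\subseteq\mathrm{FR}^{\vec e}_\mathcal{F}(\vec a)$.
   Context: An algebra $((A_\xi)_{\xi\in I},\mathcal{F})$ consists of pairwise disjoint nonempty sets $A_\xi$ (phyla) and a family $\mathcal{F}$ of operations, each from a finite product $A_{\xi_1}\times\cdots\times A_{\xi_n}$ into some $A_\xi$. Orderly terms $\mathrm{OT}(\mathcal{F})$: smallest collection containing $\mathcal{F}$ and all $\mathrm{id}_{A_\xi}$, closed under $f(\bar x_1,\dots,\bar x_k)=g(h_1(\bar x_1),\dots,h_k(\bar x_k))$ for $k$-ary $g\in\mathcal{F}$, orderly terms $h_i$ with codomains matching $g$'s arguments, and consecutive disjoint variable blocks $\bar x_i$. For infinite sequences over $\bigcup_\xi A_\xi$, $\vec a\le_\mathcal{F}\vec b$ means there are orderly terms $f_j$ and finite subsequences $\vec b_j$ of $\vec b$ with $\vec a(j)=f_j(\bar b_j)$ for all $j\in\omega$ and $\vec b_0\ast\vec b_1\ast\cdots$ a subsequence of $\vec b$. A sort is $\vec e\in{}^\omega I$; $\vec a$ is $\vec e$-sorted if $\vec a(n)\in A_{\vec e(n)}$ for all $n$. For $\vec e$-sorted $\vec b$,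 $\mathrm{FR}^{\vec e}_\mathcal{F}(\vec b)=\{\vec a(0):\vec a\le_\mathcal{F}\vec b,\ \vec a\ \vec e\text{ -sorted}\}$. $\Omega$ is the set of sorts $\vec e$ such that every index occurring in $\vec e$ occurs infinitely often. -}

module Defs where

open import Data.Nat using (ℕ; _<_)
open import Data.List using (List; []; _∷_; _++_; map; [_])
open import Data.List.Relation.Unary.All using (All; []; _∷_)
open import Data.List.Relation.Unary.Linked using (Linked)
open import Data.Product using (Σ; _×_; _,_; proj₁; ∃)
open import Relation.Binary.PropositionalEquality using (_≡_)

-- The phyla are a family A : I → Set;
-- the union ⋃ A ξ is represented as the disjoint sum Σ I A (phyla are disjoint).
record Algebra : Set₁ where
  field
    I        : Set
    A        : I → Set
    nonempty : (ξ : I) → A ξ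
    Op       : Set
    arity    : Op → List I
    cod      : Op → I
    ⟦_⟧      : (g : Op) → All A (arity g) → A (cod g)

module Theory (𝔄 : Algebra) where
  open Algebra 𝔄

  -- OTs d cs = a tuple of orderly terms h_1..h_k with codomains cs, whose
  -- consecutive disjoint variable blocks concatenate to d.
  data OT : List I → I → Set
  data OTs : List I → List I → Set

  data OT where
    idt : (ξ : I) → OT [ ξ ] ξ
    app : {d : List I} (g : Op) → OTs d (arity g) → OT d (cod g)

  data OTs where
    []  : OTs [] []
    _∷_ : {d ds : List I} {c : I} {cs : List I} →
          OT d c → OTs ds cs → OTs (d ++ ds) (c ∷ cs)

  splitAll : (xs ys : List I) → All A (xs ++ ys) → All A xs × All A ys
  splitAll []       ys v       = [] , v
  splitAll (x ∷ xs) ys (a ∷ v) with splitAll xs ys v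
  ... | (u , w) = (a ∷ u) , w

  eval  : {d : List I} {c : I} → OT d c → All A d → A c
  evals : {d cs : List I} → OTs d cs → All A d → All A cs
  eval (idt ξ) (x ∷ []) = x
  eval (app g hs) v = ⟦ g ⟧ (evals hs v)
  evals [] [] = []
  evals (_∷_ {d} {ds} h hs) v with splitAll d ds v
  ... | (u , w) = eval h u ∷ evals hs w

  U : Set
  U = Σ I A

  toArgs : (xs : List U) → All A (map proj₁ xs)
  toArgs []             = []
  toArgs ((ξ , x) ∷ xs) = x ∷ toArgs xs

  Seq : Set
  Seq = ℕ → U

  -- a ≤_F b : there are finite subsequences b_j of b (given by strictly increasing
  -- index lists idx j, with all indices of block j below all indices of block j'
  -- for j < j', so that b_0 * b_1 * ... is a subsequence of b) and orderly terms
  -- f_j with a(j) = f_j(b_j).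
  _≤F_ : Seq → Seq → Set
  a ≤F b =
    Σ (ℕ → List ℕ) λ idx →
      (∀ j → Linked _<_ (idx j)) ×
      (∀ j j' → j < j' → All (λ p → All (p <_) (idx j')) (idx j)) ×
      (∀ j → Σ I λ c → Σ (OT (map proj₁ (map b (idx j))) c) λ f →
               a j ≡ (c , eval f (toArgs (map b (idx j)))))

  Sort : Set
  Sort = ℕ → I

  Sorted : Sort → Seq → Set
  Sorted e a = ∀ n → proj₁ (a n) ≡ e n

  InΩ : Sort → Set
  InΩ e = ∀ n m → ∃ λ k → m < k × e k ≡ e n

  FR : Sort → Seq → U → Set
  FR e b x = Σ Seq λ a → a ≤F b × Sorted e a × a 0 ≡ x

-- An element of FR^{e'}(a') is b(0) for some b ≤ a', so it is the value of an
-- orderly term on a' restricted to an increasing block J of indices, and each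
-- a'(j) is in turn an orderly term on a block of a.  Orderly terms are closed
-- under composition, so b(0) is an orderly term on the concatenated blocks of
-- a, which are still increasing.  To extend b(0) to an e-sorted sequence below
-- a, use e ∈ Ω: every sort e(n+1) recurs in e beyond any bound, so after the
-- block J we can pick single elements a(k n) of the right sorts.
module Submission where

open import Defs
open import Data.Nat using (ℕ; zero; suc; _<_; s≤s)
open import Data.Nat.Properties using (<-trans; ≤-<-trans; m≤n⇒m<n∨m≡n)
open import Data.List using (List; []; _∷_; _++_; map; [_]; concat)
open import Data.List.Properties using (++-assoc; ++-identityʳ; map-++; map-∘; concat-map)
open import Data.List.Extrema.Nat using (max; xs≤max)
open import Data.List.Relation.Unary.All as All using (All; []; _∷_; universal)
open import Data.List.Relation.Unary.All.Properties using (++⁺)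
import Data.List.Relation.Unary.All.Properties as Allₚ
import Data.List.Relation.Unary.AllPairs as AllPairs
import Data.List.Relation.Unary.AllPairs.Properties as AllPairsₚ
open import Data.List.Relation.Unary.Linked using (Linked; [-])
open import Data.List.Relation.Unary.Linked.Properties using (AllPairs⇒Linked; Linked⇒AllPairs)
open import Data.List.Relation.Binary.Pointwise as Pointwise using (Pointwise; []; _∷_)
open import Data.Product using (Σ; _×_; _,_; proj₁; proj₂)
open import Data.Sum using (inj₁; inj₂)
open import Function using (_∘_)
open import Relation.Binary.PropositionalEquality
  using (_≡_; _≗_; refl; sym; trans; cong; cong₂; subst; module ≡-Reasoning)

open ≡-Reasoning

module _ {X : Set} {P : X → Set} where

  data SplitView (xs ys : List X) : All P (xs ++ ys) → Set where
    _++ᵛ_ : (u : All P xs) (w : All P ys) → SplitView xs ys (++⁺ u w)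

  splitView : ∀ xs ys (v : All P (xs ++ ys)) → SplitView xs ys v
  splitView []       ys w       = [] ++ᵛ w
  splitView (x ∷ xs) ys (p ∷ v) with splitView xs ys v
  ... | u ++ᵛ w = (p ∷ u) ++ᵛ w

  subst-∷ : ∀ {x xs ys} (eq : xs ≡ ys) (p : P x) (ps : All P xs) →
            subst (All P) (cong (x ∷_) eq) (p ∷ ps) ≡ p ∷ subst (All P) eq ps
  subst-∷ refl p ps = refl

  subst-++⁺-assoc : ∀ {xs ys zs} (u : All P xs) (v : All P ys) (w : All P zs) →
                    subst (All P) (++-assoc xs ys zs) (++⁺ (++⁺ u v) w) ≡ ++⁺ u (++⁺ v w)
  subst-++⁺-assoc []      v w = refl
  subst-++⁺-assoc (p ∷ u) v w = trans (subst-∷ _ p _) (cong (p ∷_) (subst-++⁺-assoc u v w))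

  subst-++⁺-identityʳ : ∀ {xs} (u : All P xs) → subst (All P) (++-identityʳ xs) (++⁺ u []) ≡ u
  subst-++⁺-identityʳ []      = refl
  subst-++⁺-identityʳ (p ∷ u) = trans (subst-∷ _ p _) (cong (p ∷_) (subst-++⁺-identityʳ u))

subst-sym-app : ∀ {X R : Set} {F G : X → Set} (f : ∀ {x} → F x → G x → R)
                {x y : X} (eq : x ≡ y) (t : F y) (v : G x) →
                f (subst F (sym eq) t) v ≡ f t (subst G eq v)
subst-sym-app f refl t v = refl

Precedes : List ℕ → List ℕ → Set
Precedes xs ys = All (λ p → All (p <_) ys) xs

concat-map-Linked : {idx : ℕ → List ℕ} {L : List ℕ} →
                    (∀ j → Linked _<_ (idx j)) →
                    (∀ j j' → j < j' → Precedes (idx j) (idx j')) →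
                    Linked _<_ L → Linked _<_ (concat (map idx L))
concat-map-Linked {idx} {L} idx-incr idx-ordered L-incr =
  AllPairs⇒Linked (AllPairsₚ.concat⁺
    (Allₚ.map⁺ (universal (Linked⇒AllPairs <-trans ∘ idx-incr) L))
    (AllPairsₚ.map⁺ (AllPairs.map (idx-ordered _ _) (Linked⇒AllPairs <-trans L-incr))))

step⇒strictMono : {k : ℕ → ℕ} → (∀ n → k n < k (suc n)) → ∀ {n n'} → n < n' → k n < k n'
step⇒strictMono {k} k-step {n} {suc n'} (s≤s n≤n') with m≤n⇒m<n∨m≡n n≤n'
... | inj₁ n<n' = <-trans (step⇒strictMono k-step n<n') (k-step n')
... | inj₂ refl = k-step n

module _ (𝔄 : Algebra) where
  open Algebra 𝔄
  open Theory 𝔄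

  private variable
    c : I
    d d' cs : List I

  splitAll-++⁺ : ∀ {xs ys} (u : All A xs) (w : All A ys) → splitAll xs ys (++⁺ u w) ≡ (u , w)
  splitAll-++⁺ []      w = refl
  splitAll-++⁺ (p ∷ u) w rewrite splitAll-++⁺ u w = refl

  evals-∷ : ∀ {d₁ d₂} (t : OT d₁ c) (ts : OTs d₂ cs) (u : All A d₁) (w : All A d₂) →
            evals (t ∷ ts) (++⁺ u w) ≡ eval t u ∷ evals ts w
  evals-∷ t ts u w rewrite splitAll-++⁺ u w = refl

  record SplitOTs (d₁ d₂ d : List I) (ts : OTs d (d₁ ++ d₂)) : Set where
    constructor mkSplit
    field
      e₁ e₂ : List I
      left  : OTs e₁ d₁
      right : OTs e₂ d₂
      dom   : e₁ ++ e₂ ≡ d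
      evals-split : ∀ u w → evals ts (subst (All A) dom (++⁺ u w))
                            ≡ ++⁺ (evals left u) (evals right w)

  splitOTs : ∀ d₁ d₂ (ts : OTs d (d₁ ++ d₂)) → SplitOTs d₁ d₂ d ts
  splitOTs []       d₂ ts = mkSplit [] _ [] ts refl (λ { [] w → refl })
  splitOTs (x ∷ d₁) d₂ (_∷_ {dh} t ts) with splitOTs d₁ d₂ ts
  ... | mkSplit e₁ e₂ l r refl split =
    mkSplit (dh ++ e₁) e₂ (t ∷ l) r (++-assoc dh e₁ e₂) evals-split
    where
    evals-split : ∀ u w → evals (t ∷ ts) (subst (All A) (++-assoc dh e₁ e₂) (++⁺ u w))
                          ≡ ++⁺ (evals (t ∷ l) u) (evals r w)
    evals-split u w with splitView dh e₁ u
    ... | u₁ ++ᵛ u₂ = begin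
      evals (t ∷ ts) (subst (All A) (++-assoc dh e₁ e₂) (++⁺ (++⁺ u₁ u₂) w))
        ≡⟨ cong (evals (t ∷ ts)) (subst-++⁺-assoc u₁ u₂ w) ⟩
      evals (t ∷ ts) (++⁺ u₁ (++⁺ u₂ w))    ≡⟨ evals-∷ t ts u₁ _ ⟩
      eval t u₁ ∷ evals ts (++⁺ u₂ w)        ≡⟨ cong (eval t u₁ ∷_) (split u₂ w) ⟩
      eval t u₁ ∷ ++⁺ (evals l u₂) (evals r w)
        ≡⟨ cong (λ z → ++⁺ z (evals r w)) (sym (evals-∷ t l u₁ u₂)) ⟩
      ++⁺ (evals (t ∷ l) (++⁺ u₁ u₂)) (evals r w) ∎

  compose  : (t : OT d c) (ts : OTs d' d) → Σ (OT d' c) λ t' → eval t' ≗ eval t ∘ evals ts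
  composes : (ss : OTs d cs) (ts : OTs d' d) → Σ (OTs d' cs) λ ss' → evals ss' ≗ evals ss ∘ evals ts

  compose (idt ξ) (_∷_ {dh} t []) = subst (λ d → OT d ξ) (sym (++-identityʳ dh)) t , correct
    where
    correct : ∀ v → eval (subst (λ d → OT d ξ) (sym (++-identityʳ dh)) t) v
                    ≡ eval (idt ξ) (evals (t ∷ []) v)
    correct v with splitView dh [] v
    ... | u ++ᵛ [] = begin
      eval (subst (λ d → OT d ξ) (sym (++-identityʳ dh)) t) (++⁺ u [])
        ≡⟨ subst-sym-app eval (++-identityʳ dh) t (++⁺ u []) ⟩
      eval t (subst (All A) (++-identityʳ dh) (++⁺ u [])) ≡⟨ cong (eval t) (subst-++⁺-identityʳ u) ⟩
      eval t u                                             ≡⟨ cong (eval (idt ξ)) (sym (evals-∷ t [] u [])) ⟩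
      eval (idt ξ) (evals (t ∷ []) (++⁺ u []))             ∎
  compose (app g ss) ts with composes ss ts
  ... | ss' , correct = app g ss' , cong ⟦ g ⟧ ∘ correct

  composes [] [] = [] , λ { [] → refl }
  composes (_∷_ {d₁} {d₂} s ss) ts with splitOTs d₁ d₂ ts
  ... | mkSplit e₁ e₂ l r refl split with compose s l | composes ss r
  ... | s' , s'-correct | ss' , ss'-correct = s' ∷ ss' , correct
    where
    correct : ∀ v → evals (s' ∷ ss') v ≡ evals (s ∷ ss) (evals ts v)
    correct v with splitView e₁ e₂ v
    ... | u ++ᵛ w = begin
      evals (s' ∷ ss') (++⁺ u w)                    ≡⟨ evals-∷ s' ss' u w ⟩
      eval s' u ∷ evals ss' w                       ≡⟨ cong₂ _∷_ (s'-correct u) (ss'-correct w) ⟩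
      eval s (evals l u) ∷ evals ss (evals r w)     ≡⟨ sym (evals-∷ s ss _ _) ⟩
      evals (s ∷ ss) (++⁺ (evals l u) (evals r w))  ≡⟨ cong (evals (s ∷ ss)) (sym (split u w)) ⟩
      evals (s ∷ ss) (evals ts (++⁺ u w))           ∎

  Generated : List U → U → Set
  Generated bl y = Σ I λ c → Σ (OT (map proj₁ bl) c) λ t → y ≡ (c , eval t (toArgs bl))

  subst-toArgs-++ : ∀ us ws → subst (All A) (map-++ proj₁ us ws) (toArgs (us ++ ws))
                              ≡ ++⁺ (toArgs us) (toArgs ws)
  subst-toArgs-++ []             ws = refl
  subst-toArgs-++ ((ξ , x) ∷ us) ws = trans (subst-∷ _ x _) (cong (x ∷_) (subst-toArgs-++ us ws))

  generated-tuple : ∀ {bls ys} → Pointwise Generated bls ys →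
                    Σ (OTs (map proj₁ (concat bls)) (map proj₁ ys)) λ ts →
                      evals ts (toArgs (concat bls)) ≡ toArgs ys
  generated-tuple [] = [] , refl
  generated-tuple {bl ∷ bls} {_ ∷ ys} ((c , t , refl) ∷ gens) with generated-tuple gens
  ... | ts , ts-correct = subst (λ d → OTs d (c ∷ map proj₁ ys)) (sym dom) (t ∷ ts) , (begin
    evals (subst (λ d → OTs d (c ∷ map proj₁ ys)) (sym dom) (t ∷ ts)) (toArgs (bl ++ concat bls))
      ≡⟨ subst-sym-app evals dom (t ∷ ts) _ ⟩
    evals (t ∷ ts) (subst (All A) dom (toArgs (bl ++ concat bls)))
      ≡⟨ cong (evals (t ∷ ts)) (subst-toArgs-++ bl (concat bls)) ⟩
    evals (t ∷ ts) (++⁺ (toArgs bl) (toArgs (concat bls)))  ≡⟨ evals-∷ t ts _ _ ⟩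
    eval t (toArgs bl) ∷ evals ts (toArgs (concat bls))     ≡⟨ cong (_ ∷_) ts-correct ⟩
    eval t (toArgs bl) ∷ toArgs ys                          ∎)
    where
    dom : map proj₁ (bl ++ concat bls) ≡ map proj₁ bl ++ map proj₁ (concat bls)
    dom = map-++ proj₁ bl (concat bls)

  generated-concat : ∀ {bls ys y} → Pointwise Generated bls ys → Generated ys y → Generated (concat bls) y
  generated-concat {bls} {ys} gens (c , t , refl) with generated-tuple gens
  ... | ts , ts-correct with compose t ts
  ... | t' , t'-correct = c , t' , cong (c ,_) (begin
    eval t (toArgs ys)                      ≡⟨ cong (eval t) (sym ts-correct) ⟩
    eval t (evals ts (toArgs (concat bls))) ≡⟨ sym (t'-correct _) ⟩
    eval t' (toArgs (concat bls))           ∎)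

  generated-≤F : ∀ {a a' L y} → a' ≤F a → Linked _<_ L → Generated (map a' L) y →
                 Σ (List ℕ) λ J → Linked _<_ J × Generated (map a J) y
  generated-≤F {a} {a'} {L} {y} (idx , idx-incr , idx-ordered , gen) L-incr y-gen =
    concat (map idx L) ,
    concat-map-Linked idx-incr idx-ordered L-incr ,
    subst (λ bl → Generated bl y) blocks (generated-concat gens y-gen)
    where
    gens : Pointwise Generated (map (map a ∘ idx) L) (map a' L)
    gens = Pointwise.map⁺ (map a ∘ idx) a'
      (Pointwise.refl {R = λ i j → Generated (map a (idx i)) (a' j)} (gen _))
    blocks : concat (map (map a ∘ idx) L) ≡ map a (concat (map idx L))
    blocks = trans (cong concat (map-∘ L)) (concat-map (map idx L))

  InΩ⇒tail-embedding : ∀ {e} → InΩ e → ∀ m →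
    Σ (ℕ → ℕ) λ k → (∀ n → m < k n) × (∀ n → k n < k (suc n)) × (∀ n → e (k n) ≡ e (suc n))
  InΩ⇒tail-embedding {e} eΩ m = k , above , step , sorts
    where
    k : ℕ → ℕ
    k zero    = proj₁ (eΩ 1 m)
    k (suc n) = proj₁ (eΩ (suc (suc n)) (k n))
    step : ∀ n → k n < k (suc n)
    step n = proj₁ (proj₂ (eΩ (suc (suc n)) (k n)))
    above : ∀ n → m < k n
    above zero    = proj₁ (proj₂ (eΩ 1 m))
    above (suc n) = <-trans (above n) (step n)
    sorts : ∀ n → e (k n) ≡ e (suc n)
    sorts zero    = proj₂ (proj₂ (eΩ 1 m))
    sorts (suc n) = proj₂ (proj₂ (eΩ (suc (suc n)) (k n)))

  generated⇒FR : ∀ {e a J y} → InΩ e → Sorted e a → Linked _<_ J → Generated (map a J) y →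
                 proj₁ y ≡ e 0 → FR e a y
  generated⇒FR {e} {a} {J} {y} eΩ a-sorted J-incr y-gen y-sort
    with InΩ⇒tail-embedding eΩ (max 0 J)
  ... | k , k-above , k-step , k-sorts = b , (idx , idx-incr , idx-ordered , b-gen) , b-sorted , refl
    where
    b : Seq
    b zero    = y
    b (suc n) = a (k n)
    idx : ℕ → List ℕ
    idx zero    = J
    idx (suc n) = [ k n ]
    idx-incr : ∀ j → Linked _<_ (idx j)
    idx-incr zero    = J-incr
    idx-incr (suc n) = [-]
    idx-ordered : ∀ j j' → j < j' → Precedes (idx j) (idx j')
    idx-ordered zero    (suc n') _          =
      All.map (λ p≤max → ≤-<-trans p≤max (k-above n') ∷ []) (xs≤max 0 J)
    idx-ordered (suc n) (suc n') (s≤s n<n') = (step⇒strictMono k-step n<n' ∷ []) ∷ []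
    b-gen : ∀ j → Generated (map a (idx j)) (b j)
    b-gen zero    = y-gen
    b-gen (suc n) = _ , idt _ , refl
    b-sorted : Sorted e b
    b-sorted zero    = y-sort
    b-sorted (suc n) = trans (a-sorted (k n)) (k-sorts n)

lemma5p1 : (𝔄 : Algebra) → let open Theory 𝔄 in
    (e e' : Sort) (a a' : Seq) →
    InΩ e → e' 0 ≡ e 0 → Sorted e a → Sorted e' a' → a' ≤F a →
    ∀ x → FR e' a' x → FR e a x
lemma5p1 𝔄 e e' a a' eΩ e'₀≡e₀ a-sorted _ a'≤a x
         (b , (idx , idx-incr , _ , gen) , b-sorted , refl)
  with generated-≤F 𝔄 a'≤a (idx-incr 0) (gen 0)
... | J , J-incr , x-gen = generated⇒FR 𝔄 eΩ a-sorted J-incr x-gen (trans (b-sorted 0) e'₀≡e₀)
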